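{- For all integers $n \geq 3$, $B_1(C_n)=2$ if $n=2^k$ for some positive integer $k$, and $B_1(C_n)=3$ otherwise. Moreover, if $n \neq 2^k$ for every positive integer $k$, then $\mathrm{Spec}(C_n, 1)=\{2,3\}$ if $n$ is even and $\mathrm{Spec}(C_n, 1)=\{3\}$ if $n$ is odd.
   Context: $C_n$ is the cycle with vertex set $\mathbb{Z}_n=\{0,1,\dots,n-1\}$, $i$ adjacent to $i\pm1 \pmod n$; the graph distance is $\mathrm{dist}(i,j)=\min(|i-j|,\,n-|i-j|)$, and the set of positive distances realized is $\{1,\dots,\lfloor n/2\rfloor\}$. For a set $D$ of positive integers, the distance graph $G(C_n,D)$ has vertex set $\mathbb{Z}_n$, with distinct $i,j$ adjacent iff $\mathrm{dist}(i,j)\in D$; $\chi(C_n,D)$ is its chromatic number. $B_k(C_n)=\max\{\chi(C_n,D): D\subseteq\{1,\dots,\lfloor n/2\rfloor\},\ |D|=k\}$ and $\mathrm{Spec}(C_n,k)=\{\chi(C_n,D): D\subseteq\{1,\dots,\lfloor n/2\rfloor\},\ |D|=k\}$. -}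

module Defs where

open import Data.Nat using (ℕ; _≤_; _<_; _⊓_; _∸_; ∣_-_∣; _/_; _^_)
open import Data.Fin using (Fin; toℕ)
open import Data.List using (List; length)
open import Data.List.Membership.Propositional using (_∈_)
open import Data.List.Relation.Unary.All using (All)
open import Data.List.Relation.Unary.Unique.Propositional using (Unique)
open import Data.Product using (Σ; ∃; _×_)
open import Relation.Binary.PropositionalEquality using (_≡_; _≢_)
open import Relation.Nullary using (¬_)

dist : (n : ℕ) → Fin n → Fin n → ℕ
dist n i j = ∣ toℕ i - toℕ j ∣ ⊓ (n ∸ ∣ toℕ i - toℕ j ∣)

Adj : (n : ℕ) → List ℕ → Fin n → Fin n → Set
Adj n D i j = i ≢ j × dist n i j ∈ D

Colorable : (n : ℕ) → List ℕ → ℕ → Set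
Colorable n D c =
  Σ (Fin n → Fin c) λ f → ∀ i j → Adj n D i j → f i ≢ f j

IsChi : (n : ℕ) → List ℕ → ℕ → Set
IsChi n D c = Colorable n D c × (∀ c′ → c′ < c → ¬ Colorable n D c′)

-- D is a k-element subset of {1, …, ⌊n/2⌋} (a duplicate-free list of length k).
Admissible : (n k : ℕ) → List ℕ → Set
Admissible n k D = Unique D × length D ≡ k × All (λ d → 1 ≤ d × d ≤ n / 2) D

InSpec : (n k c : ℕ) → Set
InSpec n k c = ∃ λ D → Admissible n k D × IsChi n D c

IsB : (n k b : ℕ) → Set
IsB n k b = InSpec n k b × (∀ c → InSpec n k c → c ≤ b)

IsPow2 : ℕ → Set
IsPow2 n = ∃ λ k → 1 ≤ k × n ≡ 2 ^ k

-- Two vertices of C_n are at distance d exactly when one is obtained from the other by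
-- adding d modulo n. Write d = q o with o odd. If n = 2 m q, coloring x by the parity of
-- ⌊x / q⌋ is proper: adding d adds o to ⌊x / q⌋, and wrapping around subtracts 2 m. If
-- instead n divides p d for an odd p, the multiples of d form a closed walk of odd length,
-- so two colors do not suffice. Three colors always do: alternate two colors on the blocks
-- ⌊x / d⌋ and give the last d vertices, whose shifts wrap around into the first block, the
-- third. For n a power of 2 the first case applies to every d, for odd n the second does
-- (p = n), and for n = 2^a o with o ≥ 3 odd the second applies to d = 2^a.
module Submission where

open import Defs
open import Data.Empty using (⊥-elim)
open import Data.Fin using (Fin; zero; suc; toℕ; fromℕ<; inject₁; inject≤)
open import Data.Fin.Properties
  using (toℕ<n; toℕ-fromℕ<; fromℕ<-cong; inject₁-injective; inject≤-injective)
open import Data.List using ([]; _∷_; [_])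
open import Data.List.Relation.Unary.All using ([]; _∷_)
open import Data.List.Relation.Unary.AllPairs using ([]; _∷_)
open import Data.List.Relation.Unary.Any using (here)
open import Data.Nat
open import Data.Nat.DivMod
open import Data.Nat.Divisibility using (_∣_; divides; n∣m⇒m%n≡0)
open import Data.Nat.Induction using (<-rec)
open import Data.Nat.Properties
open import Data.Parity.Base as ℙ using (Parity; 0ℙ; 1ℙ; _⁻¹)
open import Data.Parity.Properties as ℙ using (p≢p⁻¹; p+p≡0ℙ; +-homo-+)
open import Data.Product using (∃; ∃₂; _×_; _,_; proj₁; proj₂; uncurry)
open import Data.Sum using (_⊎_; inj₁; inj₂; [_,_]′; swap)
open import Function.Base using (_∘_)
open import Function.Bundles using (_⇔_; mk⇔)
open import Relation.Nullary using (¬_; yes; no)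
open import Relation.Binary.PropositionalEquality
  using (_≡_; _≢_; refl; sym; trans; cong; subst; subst₂; module ≡-Reasoning)

toFin : Parity → Fin 2
toFin 0ℙ = zero
toFin 1ℙ = suc zero

toFin-injective : ∀ {p q} → toFin p ≡ toFin q → p ≡ q
toFin-injective {0ℙ} {0ℙ} _ = refl
toFin-injective {1ℙ} {1ℙ} _ = refl

fromFin : Fin 2 → Parity
fromFin zero       = 0ℙ
fromFin (suc zero) = 1ℙ

≢⇒fromFin≡⁻¹ : {a b : Fin 2} → a ≢ b → fromFin b ≡ fromFin a ⁻¹
≢⇒fromFin≡⁻¹ {zero}     {zero}     a≢b = ⊥-elim (a≢b refl)
≢⇒fromFin≡⁻¹ {zero}     {suc zero} _   = refl
≢⇒fromFin≡⁻¹ {suc zero} {zero}     _   = refl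
≢⇒fromFin≡⁻¹ {suc zero} {suc zero} a≢b = ⊥-elim (a≢b refl)

≡⁻¹⇒toFin≢ : ∀ {p q} → q ≡ p ⁻¹ → toFin p ≢ toFin q
≡⁻¹⇒toFin≢ {p} q≡p⁻¹ eq = p≢p⁻¹ p (trans (toFin-injective eq) q≡p⁻¹)

Odd : ℕ → Set
Odd n = parity n ≡ 1ℙ

parity-double : ∀ m → parity (m + m) ≡ 0ℙ
parity-double m = trans (+-homo-+ m m) (p+p≡0ℙ (parity m))

parity-odd+ : ∀ o → Odd o → ∀ x → parity (o + x) ≡ parity x ⁻¹
parity-odd+ o odd x = trans (+-homo-+ o x) (cong (ℙ._+ parity x) odd)

parity-double+ : ∀ m x → parity (m + m + x) ≡ parity x
parity-double+ m x = trans (+-homo-+ (m + m) x) (cong (ℙ._+ parity x) (parity-double m))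

alternating⇒parity : (g : ℕ → Parity) → (∀ k → g (suc k) ≡ g k ⁻¹) →
                     ∀ k → g k ≡ parity k ℙ.+ g 0
alternating⇒parity g step zero    = refl
alternating⇒parity g step (suc k) = begin
  g (suc k)                       ≡⟨ step k ⟩
  g k ⁻¹                          ≡⟨ cong _⁻¹ (alternating⇒parity g step k) ⟩
  1ℙ ℙ.+ (parity k ℙ.+ g 0)       ≡⟨ sym (ℙ.+-assoc 1ℙ (parity k) (g 0)) ⟩
  (1ℙ ℙ.+ parity k) ℙ.+ g 0       ≡⟨ cong (ℙ._+ g 0) (sym (+-homo-+ 1 k)) ⟩
  parity (suc k) ℙ.+ g 0          ∎
  where open ≡-Reasoning

m*2≡m+m : ∀ m → m * 2 ≡ m + m
m*2≡m+m m = trans (*-suc m 1) (cong (m +_) (*-identityʳ m))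

even-or-odd : ∀ n → (∃ λ h → n ≡ h + h) ⊎ (∃ λ h → n ≡ suc (h + h))
even-or-odd zero = inj₁ (0 , refl)
even-or-odd (suc n) with even-or-odd n
... | inj₁ (h , refl) = inj₂ (h , refl)
... | inj₂ (h , refl) = inj₁ (suc h , cong suc (sym (+-suc h h)))

odd-suc-double : ∀ h → Odd (suc (h + h))
odd-suc-double h = trans (+-homo-+ 1 (h + h)) (cong (1ℙ ℙ.+_) (parity-double h))

¬2∣⇒odd : ∀ {n} → ¬ 2 ∣ n → Odd n
¬2∣⇒odd {n} 2∤n with even-or-odd n
... | inj₁ (h , refl) = ⊥-elim (2∤n (divides h (sym (m*2≡m+m h))))
... | inj₂ (h , refl) = odd-suc-double h

odd⇒nonZero : ∀ {o} → Odd o → NonZero o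
odd⇒nonZero {suc o} _ = _

∃2^a*odd : ∀ m → 1 ≤ m → ∃₂ λ a o → Odd o × m ≡ 2 ^ a * o
∃2^a*odd = <-rec _ decompose
  where
  decompose : ∀ m → (∀ {k} → k < m → 1 ≤ k → ∃₂ λ a o → Odd o × k ≡ 2 ^ a * o) →
              1 ≤ m → ∃₂ λ a o → Odd o × m ≡ 2 ^ a * o
  decompose m rec 1≤m with even-or-odd m
  ... | inj₂ (h , refl) = 0 , m , odd-suc-double h , sym (*-identityˡ m)
  ... | inj₁ (suc h , refl) with rec (m<m+n (suc h) z<s) z<s
  ...   | a , o , odd , h′≡2^ao = suc a , o , odd , (begin
    suc h + suc h      ≡⟨ sym (m*2≡m+m (suc h)) ⟩
    suc h * 2          ≡⟨ *-comm (suc h) 2 ⟩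
    2 * suc h          ≡⟨ cong (2 *_) h′≡2^ao ⟩
    2 * (2 ^ a * o)    ≡⟨ sym (*-assoc 2 (2 ^ a) o) ⟩
    2 ^ suc a * o      ∎)
    where open ≡-Reasoning

Shift : ℕ → ℕ → ℕ → ℕ → Set
Shift n d x y = d + x ≡ y ⊎ d + x ≡ n + y

dist-self : ∀ {n} (i : Fin n) → dist n i i ≡ 0
dist-self {n} i = cong (λ e → e ⊓ (n ∸ e)) (∣n-n∣≡0 (toℕ i))

dist-sym : ∀ {n} (i j : Fin n) → dist n i j ≡ dist n j i
dist-sym {n} i j = cong (λ e → e ⊓ (n ∸ e)) (∣-∣-comm (toℕ i) (toℕ j))

dist-+ : ∀ {n e} (i j : Fin n) → e + toℕ j ≡ toℕ i → dist n i j ≡ e ⊓ (n ∸ e)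
dist-+ {n} {e} i j e+y≡x = cong (λ e′ → e′ ⊓ (n ∸ e′)) (begin
  ∣ toℕ i - toℕ j ∣       ≡⟨ cong (∣_- toℕ j ∣) (trans (sym e+y≡x) (+-comm e (toℕ j))) ⟩
  ∣ toℕ j + e - toℕ j ∣   ≡⟨ ∣-∣-comm (toℕ j + e) (toℕ j) ⟩
  ∣ toℕ j - toℕ j + e ∣   ≡⟨ ∣m-m+n∣≡n (toℕ j) e ⟩
  e                       ∎)
  where open ≡-Reasoning

d*2≤n⇒d≤n∸d : ∀ {n d} → d * 2 ≤ n → d ≤ n ∸ d
d*2≤n⇒d≤n∸d {n} {d} d*2≤n = m+n≤o⇒m≤o∸n d (subst (_≤ n) (m*2≡m+m d) d*2≤n)

d*2≤n⇒d<n : ∀ {n d} → 1 ≤ d → d * 2 ≤ n → d < n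
d*2≤n⇒d<n {d = d} 1≤d d*2≤n =
  <-≤-trans (subst (d <_) (sym (m*2≡m+m d)) (m<m+n d 1≤d)) d*2≤n

shift⇒adj : ∀ {n d} → 1 ≤ d → d * 2 ≤ n → (i j : Fin n) →
            Shift n d (toℕ i) (toℕ j) → Adj n [ d ] i j
shift⇒adj {n} {d} 1≤d d*2≤n i j shift = i≢j , here dist≡d
  where
  d≤n∸d = d*2≤n⇒d≤n∸d d*2≤n
  d≤n   = ≤-trans d≤n∸d (m∸n≤m n d)
  wrap : d + toℕ i ≡ n + toℕ j → n ∸ d + toℕ j ≡ toℕ i
  wrap d+x≡n+y = +-cancelˡ-≡ d _ _ (begin
    d + (n ∸ d + toℕ j)   ≡⟨ sym (+-assoc d (n ∸ d) (toℕ j)) ⟩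
    d + (n ∸ d) + toℕ j   ≡⟨ cong (_+ toℕ j) (m+[n∸m]≡n d≤n) ⟩
    n + toℕ j             ≡⟨ sym d+x≡n+y ⟩
    d + toℕ i             ∎)
    where open ≡-Reasoning
  dist≡d : dist n i j ≡ d
  dist≡d = [ (λ d+x≡y → trans (dist-sym i j) (trans (dist-+ j i d+x≡y) (m≤n⇒m⊓n≡m d≤n∸d)))
           , (λ d+x≡n+y → trans (dist-+ i j (wrap d+x≡n+y))
               (trans (cong ((n ∸ d) ⊓_) (m∸[m∸n]≡n d≤n)) (m≥n⇒m⊓n≡n d≤n∸d)))
           ]′ shift
  i≢j : i ≢ j
  i≢j i≡j = <⇒≢ 1≤d (begin
    0             ≡⟨ sym (dist-self i) ⟩
    dist n i i    ≡⟨ cong (dist n i) i≡j ⟩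
    dist n i j    ≡⟨ dist≡d ⟩
    d             ∎)
    where open ≡-Reasoning

cyclicDistance⇒shift : ∀ {n d e x y} → e + y ≡ x → x < n → e ⊓ (n ∸ e) ≡ d →
            Shift n d y x ⊎ Shift n d x y
cyclicDistance⇒shift {n} {d} {e} {x} {y} e+y≡x x<n min≡d with ⊓-sel e (n ∸ e)
... | inj₁ min≡e = inj₁ (inj₁ (trans (cong (_+ y) (trans (sym min≡d) min≡e)) e+y≡x))
... | inj₂ min≡n∸e = inj₂ (inj₂ (begin
  d + x               ≡⟨ cong (_+ x) (trans (sym min≡d) min≡n∸e) ⟩
  n ∸ e + x           ≡⟨ cong (n ∸ e +_) (sym e+y≡x) ⟩
  n ∸ e + (e + y)     ≡⟨ sym (+-assoc (n ∸ e) e y) ⟩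
  n ∸ e + e + y       ≡⟨ cong (_+ y) (m∸n+n≡m e≤n) ⟩
  n + y               ∎))
  where
  open ≡-Reasoning
  e≤n : e ≤ n
  e≤n = ≤-trans (subst (e ≤_) e+y≡x (m≤m+n e y)) (<⇒≤ x<n)

adj⇒shift : ∀ {n d} (i j : Fin n) → Adj n [ d ] i j →
            Shift n d (toℕ i) (toℕ j) ⊎ Shift n d (toℕ j) (toℕ i)
adj⇒shift i j (_ , here dist≡d) with ≤-total (toℕ j) (toℕ i)
... | inj₁ j≤i = swap (cyclicDistance⇒shift (m∸n+n≡m j≤i) (toℕ<n i)
  (trans (sym (dist-+ i j (m∸n+n≡m j≤i))) dist≡d))
... | inj₂ i≤j = cyclicDistance⇒shift (m∸n+n≡m i≤j) (toℕ<n j)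
  (trans (sym (dist-+ j i (m∸n+n≡m i≤j))) (trans (dist-sym j i) dist≡d))

colorable-by-shifts : ∀ {n d c} (F : ℕ → Fin c) →
  (∀ {x y} → x < n → y < n → Shift n d x y → F x ≢ F y) → Colorable n [ d ] c
colorable-by-shifts {n} {d} F separates = (λ i → F (toℕ i)) , proper
  where
  proper : ∀ i j → Adj n [ d ] i j → F (toℕ i) ≢ F (toℕ j)
  proper i j adj with adj⇒shift i j adj
  ... | inj₁ shift = separates (toℕ<n i) (toℕ<n j) shift
  ... | inj₂ shift = λ Fx≡Fy → separates (toℕ<n j) (toℕ<n i) shift (sym Fx≡Fy)

shift-% : ∀ {n d x} .{{_ : NonZero n}} → d < n → x < n → Shift n d x ((d + x) % n)
shift-% {n} {d} {x} d<n x<n with d + x <? n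
... | yes d+x<n = inj₁ (sym (m<n⇒m%n≡m d+x<n))
... | no d+x≮n  = inj₂ (begin
  d + x               ≡⟨ sym (m+[n∸m]≡n n≤d+x) ⟩
  n + (d + x ∸ n)     ≡⟨ cong (n +_) (sym (m<n⇒m%n≡m (m<n+o⇒m∸n<o (d + x) n (+-mono-< d<n x<n)))) ⟩
  n + (d + x ∸ n) % n ≡⟨ cong (n +_) (m≤n⇒[n∸m]%m≡n%m n≤d+x) ⟩
  n + (d + x) % n     ∎)
  where
  open ≡-Reasoning
  n≤d+x = ≮⇒≥ d+x≮n

/-shift : ∀ q k x .{{_ : NonZero q}} → (q * k + x) / q ≡ k + x / q
/-shift q k x = begin
  (q * k + x) / q     ≡⟨ +-distrib-/-∣ˡ x (divides k (*-comm q k)) ⟩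
  q * k / q + x / q   ≡⟨ cong (λ m → m / q + x / q) (*-comm q k) ⟩
  k * q / q + x / q   ≡⟨ cong (_+ x / q) (m*n/n≡m k q) ⟩
  k + x / q           ∎
  where open ≡-Reasoning

parity-/-shift : ∀ q o → Odd o → ∀ x .{{_ : NonZero q}} →
                 parity ((q * o + x) / q) ≡ parity (x / q) ⁻¹
parity-/-shift q o odd x = trans (cong parity (/-shift q o x)) (parity-odd+ o odd (x / q))

2-colorable : ∀ {n d q o m} .{{_ : NonZero q}} → Odd o → d ≡ q * o → n ≡ q * (m + m) →
              Colorable n [ d ] 2
2-colorable {n} {d} {q} {o} {m} odd refl refl =
  colorable-by-shifts (λ x → toFin (parity (x / q))) λ _ _ → separates
  where
  separates : ∀ {x y} → Shift n d x y → toFin (parity (x / q)) ≢ toFin (parity (y / q))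
  separates {x} (inj₁ refl) = ≡⁻¹⇒toFin≢ (parity-/-shift q o odd x)
  separates {x} {y} (inj₂ d+x≡n+y) = ≡⁻¹⇒toFin≢ (begin
    parity (y / q)                     ≡⟨ sym (parity-double+ m (y / q)) ⟩
    parity (m + m + y / q)             ≡⟨ cong parity (sym (/-shift q (m + m) y)) ⟩
    parity ((q * (m + m) + y) / q)     ≡⟨ cong (λ z → parity (z / q)) (sym d+x≡n+y) ⟩
    parity ((q * o + x) / q)           ≡⟨ parity-/-shift q o odd x ⟩
    parity (x / q) ⁻¹                  ∎)
    where open ≡-Reasoning

blockColor : (n d : ℕ) .{{_ : NonZero d}} → ℕ → Fin 3
blockColor n d x with x <? n ∸ d
... | yes _ = inject₁ (toFin (parity (x / d)))
... | no _  = suc (suc zero)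

blockColor-low : ∀ n {d x} .{{_ : NonZero d}} → x < n ∸ d →
                 blockColor n d x ≡ inject₁ (toFin (parity (x / d)))
blockColor-low n {d} {x} x<n∸d with x <? n ∸ d
... | yes _    = refl
... | no x≮n∸d = ⊥-elim (x≮n∸d x<n∸d)

blockColor-high : ∀ n {d x} .{{_ : NonZero d}} → n ∸ d ≤ x → blockColor n d x ≡ suc (suc zero)
blockColor-high n {d} {x} n∸d≤x with x <? n ∸ d
... | yes x<n∸d = ⊥-elim (<⇒≱ x<n∸d n∸d≤x)
... | no _      = refl

inject₁-toFin≢last : ∀ p → inject₁ (toFin p) ≢ suc (suc zero)
inject₁-toFin≢last 0ℙ ()
inject₁-toFin≢last 1ℙ ()

3-colorable : ∀ {n d} → 1 ≤ d → d * 2 ≤ n → Colorable n [ d ] 3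
3-colorable {n} {d} 1≤d d*2≤n = colorable-by-shifts (blockColor n d) separates
  where
  instance _ = >-nonZero 1≤d
  separates : ∀ {x y} → x < n → y < n → Shift n d x y → blockColor n d x ≢ blockColor n d y
  separates {x} _ d+x<n (inj₁ refl) with <-≤-connex (d + x) (n ∸ d)
  ... | inj₁ d+x<n∸d = subst₂ _≢_ (sym (blockColor-low n (≤-<-trans (m≤n+m x d) d+x<n∸d)))
                                 (sym (blockColor-low n d+x<n∸d))
                                 (λ eq → ≡⁻¹⇒toFin≢ flips (inject₁-injective eq))
    where
    flips : parity ((d + x) / d) ≡ parity (x / d) ⁻¹
    flips = trans (cong (λ z → parity ((z + x) / d)) (sym (*-identityʳ d)))
                  (parity-/-shift d 1 refl x)
  ... | inj₂ n∸d≤d+x = subst₂ _≢_ (sym (blockColor-low n x<n∸d)) (sym (blockColor-high n n∸d≤d+x))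
                                 (inject₁-toFin≢last _)
    where
    x<n∸d : x < n ∸ d
    x<n∸d = m+n≤o⇒m≤o∸n (suc x) (subst (_< n) (+-comm d x) d+x<n)
  separates {x} {y} x<n _ (inj₂ d+x≡n+y) =
    subst₂ _≢_ (sym (blockColor-high n n∸d≤x)) (sym (blockColor-low n y<n∸d))
               (λ eq → inject₁-toFin≢last _ (sym eq))
    where
    n∸d≤x : n ∸ d ≤ x
    n∸d≤x = m≤n+o⇒m∸n≤o n d (subst (n ≤_) (sym d+x≡n+y) (m≤m+n n y))
    y<n∸d : y < n ∸ d
    y<n∸d = <-≤-trans (+-cancelˡ-< n y d (subst (_< n + d) d+x≡n+y
                        (subst (d + x <_) (+-comm d n) (+-monoʳ-< d x<n))))
                      (d*2≤n⇒d≤n∸d d*2≤n)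

oddClosedWalk⇒¬proper : ∀ {V : Set} {_~_ : V → V → Set} (f : V → Fin 2) →
  (∀ {u v} → u ~ v → f u ≢ f v) → (w : ℕ → V) → (∀ k → w k ~ w (suc k)) →
  ∀ p → Odd p → w p ≢ w 0
oddClosedWalk⇒¬proper f proper w step p odd wp≡w0 =
  p≢p⁻¹ (color 0) (begin
    color 0                   ≡⟨ cong (fromFin ∘ f) (sym wp≡w0) ⟩
    color p                   ≡⟨ alternating⇒parity color (≢⇒fromFin≡⁻¹ ∘ proper ∘ step) p ⟩
    parity p ℙ.+ color 0      ≡⟨ cong (ℙ._+ color 0) odd ⟩
    color 0 ⁻¹                ∎)
  where
  open ≡-Reasoning
  color : ℕ → Parity
  color k = fromFin (f (w k))

¬2-colorable : ∀ {n d} → 1 ≤ d → d * 2 ≤ n → ∀ p → Odd p → n ∣ p * d →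
               ¬ Colorable n [ d ] 2
¬2-colorable {n} {d} 1≤d d*2≤n p odd n∣pd (f , proper) =
  oddClosedWalk⇒¬proper f (proper _ _) multiple step p odd closes
  where
  d<n = d*2≤n⇒d<n 1≤d d*2≤n
  instance _ = >-nonZero (≤-<-trans z≤n d<n)
  multiple : ℕ → Fin n
  multiple k = fromℕ< (m%n<n (k * d) n)
  step : ∀ k → Adj n [ d ] (multiple k) (multiple (suc k))
  step k = shift⇒adj 1≤d d*2≤n (multiple k) (multiple (suc k))
    (subst₂ (Shift n d) (sym (toℕ-fromℕ< _)) (sym (trans (toℕ-fromℕ< _) suc-k·d%n))
            (shift-% d<n (m%n<n (k * d) n)))
    where
    suc-k·d%n : (d + k * d) % n ≡ (d + (k * d) % n) % n
    suc-k·d%n = trans (%-distribˡ-+ d (k * d) n) (sym (trans (%-distribˡ-+ d (k * d % n) n)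
      (cong (λ r → (d % n + r) % n) (m%n%n≡m%n (k * d) n))))
  closes : multiple p ≡ multiple 0
  closes = fromℕ<-cong _ _ (trans (n∣m⇒m%n≡0 (p * d) n n∣pd) (sym (m*n%n≡0 0 n))) _ _

Fin-≢⇒2≤ : ∀ {c} {a b : Fin c} → a ≢ b → 2 ≤ c
Fin-≢⇒2≤ {suc zero}    {zero} {zero} a≢b = ⊥-elim (a≢b refl)
Fin-≢⇒2≤ {suc (suc c)} _                 = s≤s (s≤s z≤n)

colorable-mono : ∀ {n D c c′} → c ≤ c′ → Colorable n D c → Colorable n D c′
colorable-mono c≤c′ (f , proper) = (λ i → inject≤ (f i) c≤c′) ,
  λ i j adj eq → proper i j adj (inject≤-injective c≤c′ c≤c′ (f i) (f j) eq)

adj⇒2≤colors : ∀ {n D c i j} → Adj n D i j → Colorable n D c → 2 ≤ c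
adj⇒2≤colors {i = i} {j} adj (f , proper) = Fin-≢⇒2≤ (proper i j adj)

isChi-intro : ∀ {n D c} → Colorable n D (suc c) → ¬ Colorable n D c → IsChi n D (suc c)
isChi-intro col ¬col = col , λ c′ c′<1+c col′ → ¬col (colorable-mono (s≤s⁻¹ c′<1+c) col′)

isChi-≤ : ∀ {n D c c′} → IsChi n D c → Colorable n D c′ → c ≤ c′
isChi-≤ (_ , minimal) col′ = ≮⇒≥ (λ c′<c → minimal _ c′<c col′)

isChi-> : ∀ {n D c c′} → IsChi n D c → ¬ Colorable n D c′ → c′ < c
isChi-> (col , _) ¬col = ≰⇒> (λ c≤c′ → ¬col (colorable-mono c≤c′ col))

colorable⇒2≤ : ∀ {n d c} → 1 ≤ d → d * 2 ≤ n → Colorable n [ d ] c → 2 ≤ c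
colorable⇒2≤ {n} {d} 1≤d d*2≤n =
  adj⇒2≤colors (shift⇒adj 1≤d d*2≤n (fromℕ< 0<n) (fromℕ< d<n) 0↦d)
  where
  d<n = d*2≤n⇒d<n 1≤d d*2≤n
  0<n = ≤-<-trans z≤n d<n
  0↦d : Shift n d (toℕ (fromℕ< 0<n)) (toℕ (fromℕ< d<n))
  0↦d = inj₁ (trans (cong (d +_) (toℕ-fromℕ< 0<n))
                    (trans (+-identityʳ d) (sym (toℕ-fromℕ< d<n))))

isChi⇒2≤×≤3 : ∀ {n d c} → 1 ≤ d → d * 2 ≤ n → IsChi n [ d ] c → 2 ≤ c × c ≤ 3
isChi⇒2≤×≤3 1≤d d*2≤n χ =
  colorable⇒2≤ 1≤d d*2≤n (proj₁ χ) , isChi-≤ χ (3-colorable 1≤d d*2≤n)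

2≤×≤3⇒2or3 : ∀ {c} → 2 ≤ c → c ≤ 3 → c ≡ 2 ⊎ c ≡ 3
2≤×≤3⇒2or3 {1} (s≤s ()) _
2≤×≤3⇒2or3 {2} _ _ = inj₁ refl
2≤×≤3⇒2or3 {3} _ _ = inj₂ refl
2≤×≤3⇒2or3 {suc (suc (suc (suc _)))} _ (s≤s (s≤s (s≤s ())))

inSpec-singleton : ∀ {n d c} → 1 ≤ d → d * 2 ≤ n → IsChi n [ d ] c → InSpec n 1 c
inSpec-singleton {n} {d} 1≤d d*2≤n χ =
  [ d ] , (([] ∷ []) , refl , ((1≤d , d≤n/2) ∷ [])) , χ
  where
  d≤n/2 : d ≤ n / 2
  d≤n/2 = subst (_≤ n / 2) (m*n/n≡m d 2) (/-monoˡ-≤ 2 d*2≤n)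

inSpec⇒singleton : ∀ {n c} → InSpec n 1 c → ∃ λ d → 1 ≤ d × d * 2 ≤ n × IsChi n [ d ] c
inSpec⇒singleton {n} ((d ∷ []) , (_ , refl , ((1≤d , d≤n/2) ∷ [])) , χ) =
  d , 1≤d , ≤-trans (*-monoˡ-≤ 2 d≤n/2) (m/n*n≤m n 2) , χ

inSpec⇒2≤×≤3 : ∀ {n c} → InSpec n 1 c → 2 ≤ c × c ≤ 3
inSpec⇒2≤×≤3 spec with inSpec⇒singleton spec
... | d , 1≤d , d*2≤n , χ = isChi⇒2≤×≤3 1≤d d*2≤n χ

pow2⇒2∣ : ∀ {n} → IsPow2 n → 2 ∣ n
pow2⇒2∣ (suc k , _ , refl) = divides (2 ^ k) (*-comm 2 (2 ^ k))

pow2⇒2-colorable : ∀ {n d} → IsPow2 n → 1 ≤ d → d < n → Colorable n [ d ] 2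
pow2⇒2-colorable {d = d} (k , _ , refl) 1≤d d<n with ∃2^a*odd d 1≤d
... | a , o , odd , d≡2^ao with a <? k
...   | no a≮k = ⊥-elim (<⇒≱ d<n (begin
    2 ^ k      ≤⟨ ^-monoʳ-≤ 2 (≮⇒≥ a≮k) ⟩
    2 ^ a      ≤⟨ m≤m*n (2 ^ a) o ⟩
    2 ^ a * o  ≡⟨ sym d≡2^ao ⟩
    d          ∎))
  where
  open ≤-Reasoning
  instance _ = odd⇒nonZero odd
...   | yes a<k with m≤n⇒∃[o]m+o≡n a<k
...     | b , refl = 2-colorable {q = 2 ^ a} {o} {2 ^ b} odd d≡2^ao (begin
    2 ^ (suc a + b)                ≡⟨ cong (2 ^_) (sym (+-suc a b)) ⟩
    2 ^ (a + suc b)                ≡⟨ ^-distribˡ-+-* 2 a (suc b) ⟩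
    2 ^ a * (2 ^ b + (2 ^ b + 0))  ≡⟨ cong (λ m → 2 ^ a * (2 ^ b + m)) (+-identityʳ (2 ^ b)) ⟩
    2 ^ a * (2 ^ b + 2 ^ b)        ∎)
  where
  open ≡-Reasoning
  instance _ = m^n≢0 2 a

pow2⇒inSpec≤2 : ∀ {n c} → IsPow2 n → InSpec n 1 c → c ≤ 2
pow2⇒inSpec≤2 pow2 spec with inSpec⇒singleton spec
... | d , 1≤d , d*2≤n , χ = isChi-≤ χ (pow2⇒2-colorable pow2 1≤d (d*2≤n⇒d<n 1≤d d*2≤n))

2∣⇒inSpec-2 : ∀ {n} → 2 ≤ n → 2 ∣ n → InSpec n 1 2
2∣⇒inSpec-2 {n} 2≤n (divides m n≡m*2) =
  inSpec-singleton ≤-refl 2≤n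
    (isChi-intro 2-col (λ col → <-irrefl refl (colorable⇒2≤ ≤-refl 2≤n col)))
  where
  2-col : Colorable n [ 1 ] 2
  2-col = 2-colorable {q = 1} {1} {m} refl refl
    (trans n≡m*2 (trans (m*2≡m+m m) (sym (*-identityˡ (m + m)))))

¬pow2⇒odd-part≥2 : ∀ {n a o} → Odd o → n ≡ 2 ^ a * o → 3 ≤ n → ¬ IsPow2 n → 2 ≤ o
¬pow2⇒odd-part≥2 {a = zero}  {1} _ refl (s≤s ()) _
¬pow2⇒odd-part≥2 {a = suc a} {1} _ n≡2^a*1 _ ¬pow2 =
  ⊥-elim (¬pow2 (suc a , s≤s z≤n , trans n≡2^a*1 (*-identityʳ (2 ^ suc a))))
¬pow2⇒odd-part≥2 {o = suc (suc o)} _ _ _ _ = s≤s (s≤s z≤n)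

¬pow2⇒inSpec-3 : ∀ {n} → 3 ≤ n → ¬ IsPow2 n → InSpec n 1 3
¬pow2⇒inSpec-3 {n} 3≤n ¬pow2 with ∃2^a*odd n (≤-trans (s≤s z≤n) 3≤n)
... | a , o , odd , n≡2^ao = inSpec-singleton 1≤2^a 2^a*2≤n
  (isChi-intro (3-colorable 1≤2^a 2^a*2≤n)
               (¬2-colorable 1≤2^a 2^a*2≤n o odd (divides 1 o*2^a≡1*n)))
  where
  1≤2^a = m^n>0 2 a
  2^a*2≤n : 2 ^ a * 2 ≤ n
  2^a*2≤n = ≤-trans (*-monoʳ-≤ (2 ^ a) (¬pow2⇒odd-part≥2 {a = a} odd n≡2^ao 3≤n ¬pow2))
                    (≤-reflexive (sym n≡2^ao))
  o*2^a≡1*n : o * 2 ^ a ≡ 1 * n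
  o*2^a≡1*n = trans (*-comm o (2 ^ a)) (trans (sym n≡2^ao) (sym (*-identityˡ n)))

¬2∣⇒inSpec≡3 : ∀ {n c} → ¬ 2 ∣ n → InSpec n 1 c → c ≡ 3
¬2∣⇒inSpec≡3 {n} 2∤n spec with inSpec⇒singleton spec
... | d , 1≤d , d*2≤n , χ = ≤-antisym (proj₂ (isChi⇒2≤×≤3 1≤d d*2≤n χ))
  (isChi-> χ (¬2-colorable 1≤d d*2≤n n (¬2∣⇒odd 2∤n) (divides d (*-comm n d))))

theorem3p1p1 : (n : ℕ) → 3 ≤ n →
    (IsPow2 n → IsB n 1 2) ×
    (¬ IsPow2 n → IsB n 1 3) ×
    (¬ IsPow2 n →
      ((2 ∣ n → ∀ c → InSpec n 1 c ⇔ (c ≡ 2 ⊎ c ≡ 3)) ×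
       (¬ (2 ∣ n) → ∀ c → InSpec n 1 c ⇔ c ≡ 3)))
theorem3p1p1 n 3≤n =
    (λ pow2 → 2∣⇒inSpec-2 2≤n (pow2⇒2∣ pow2) , λ c → pow2⇒inSpec≤2 pow2)
  , (λ ¬pow2 → ¬pow2⇒inSpec-3 3≤n ¬pow2 , λ c spec → proj₂ (inSpec⇒2≤×≤3 spec))
  , λ ¬pow2 →
      (λ 2∣n c → mk⇔ (uncurry 2≤×≤3⇒2or3 ∘ inSpec⇒2≤×≤3)
                     [ (λ { refl → 2∣⇒inSpec-2 2≤n 2∣n })
                     , (λ { refl → ¬pow2⇒inSpec-3 3≤n ¬pow2 }) ]′)
    , (λ 2∤n c → mk⇔ (¬2∣⇒inSpec≡3 2∤n) λ { refl → ¬pow2⇒inSpec-3 3≤n ¬pow2 })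
  where
  2≤n = ≤-trans (n≤1+n 2) 3≤n
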